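{- Let $P(X)=\sum_{i=0}^k A_iX^i$ be a polynomial whose coefficients are permutations, such that the coefficient $A_i$ of at least one non-constant monomial ($i\ge1$) contains a fixed point. Then $P$ is injective over the semiring of permutations: for all permutations $X,Y$, $P(X)=P(Y)$ implies $X=Y$.
   Context: An FDDS is a finite set with a total function on it, viewed as a functional digraph up to isomorphism; a permutation is an FDDS whose function is bijective, i.e. a disjoint union of cycles. Sum is disjoint union and product the direct product of digraphs (vertex set $V(A)\times V(B)$, arc $(u,u')\to(v,v')$ iff $u\to v$ and $u'\to v'$); $X^0$ is the single fixed point. A fixed point is a cycle of length $1$. -}

module Defs where

open import Data.Nat using (ℕ; zero; suc; _+_; _*_)
import Data.Fin
open import Data.Fin using (Fin; splitAt; join; remQuot; combine)
open import Data.Sum using (_⊎_; inj₁; inj₂) renaming (map to map⊎)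
open import Data.Product using (Σ; _×_; _,_; proj₁; proj₂)
open import Function.Bundles using (_↔_; Inverse)
open import Function.Definitions using (Bijective)
open import Relation.Binary.PropositionalEquality using (_≡_)

record FDDS : Set where
  constructor mkFDDS
  field
    size : ℕ
    fn   : Fin size → Fin size
open FDDS public

_≅_ : FDDS → FDDS → Set
A ≅ B = Σ (Fin (size A) ↔ Fin (size B)) λ φ →
          ∀ x → Inverse.to φ (fn A x) ≡ fn B (Inverse.to φ x)

IsPerm : FDDS → Set
IsPerm A = Bijective _≡_ _≡_ (fn A)

HasFixedPoint : FDDS → Set
HasFixedPoint A = Σ (Fin (size A)) λ x → fn A x ≡ x

𝟘 : FDDS
𝟘 = mkFDDS 0 (λ ())

_⊕_ : FDDS → FDDS → FDDS
A ⊕ B = mkFDDS (size A + size B)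
  (λ x → join (size A) (size B) (map⊎ (fn A) (fn B) (splitAt (size A) x)))

_⊗_ : FDDS → FDDS → FDDS
A ⊗ B = mkFDDS (size A * size B)
  (λ x → let p = remQuot {size A} (size B) x
         in combine (fn A (proj₁ p)) (fn B (proj₂ p)))

𝟙 : FDDS
𝟙 = mkFDDS 1 (λ x → x)

_^_ : FDDS → ℕ → FDDS
X ^ zero  = 𝟙
X ^ suc i = X ⊗ (X ^ i)

sumTo : (k : ℕ) → (Fin (suc k) → FDDS) → FDDS
sumTo zero    f = f Data.Fin.zero
sumTo (suc k) f = sumTo k (λ i → f (Data.Fin.inject₁ i)) ⊕ f (Data.Fin.fromℕ (suc k))

evalPoly : (k : ℕ) → (Fin (suc k) → FDDS) → FDDS → FDDS
evalPoly k A X = sumTo k (λ i → A i ⊗ (X ^ Data.Fin.toℕ i))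

{-# OPTIONS --safe #-}
-- Let periodicPoints t X count the points of X fixed by the t-th iterate of its map. It is
-- additive on sums, multiplicative on products and invariant under isomorphism, so it sends
-- P(X) to the natural-number polynomial whose coefficients are the counts for the Aᵢ. A fixed
-- point of some Aⱼ with j ≥ 1 makes that coefficient positive for every t, so this polynomial
-- is strictly increasing and X, Y have the same counts for every t. Two permutations with the
-- same counts are isomorphic: the least t > 0 for which X has t-periodic points is the length
-- of a shortest cycle of X, hence Y has a cycle of that length too; removing one such cycle
-- from each keeps the counts equal, and induction on the size concludes.
module Submission where

open import Data.Empty.Irrelevant using () renaming (⊥-elim to ⊥-elim-irr)
open import Data.Fin
  using (Fin; zero; suc; toℕ; fromℕ; fromℕ<; inject₁; _↑ˡ_; _↑ʳ_; splitAt; join; combine; _≟_)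
open import Data.Fin.Permutation using (↔⇒≡)
open import Data.Fin.Properties
  using (toℕ-injective; toℕ<n; toℕ≤pred[n]; toℕ-fromℕ; toℕ-fromℕ<; toℕ-inject; toℕ-inject₁;
         ↑ˡ-injective; ↑ʳ-injective; splitAt-↑ˡ; splitAt-↑ʳ; splitAt-join; join-splitAt;
         remQuot-combine; combine-injective; any?; pigeonhole; ¬∀⟶∃¬-smallest)
open import Data.Nat
  using (ℕ; zero; suc; _+_; _*_; _^_; _<_; _≤_; _<?_; z≤n; z<s; s≤s; NonZero; >-nonZero)
open import Data.Nat.DivMod using (_%_; _/_; _mod_; m%n<n; m≡m%n+[m/n]*n; n%n≡0; m<n⇒m%n≡m)
open import Data.Nat.GeneralisedArithmetic using (fold; fold-+)
open import Data.Nat.Induction using (Acc; acc; <-wellFounded)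
open import Data.Nat.Properties
  using (+-*-semiring; +-assoc; +-suc; +-identityʳ; +-cancelˡ-≡; +-mono-≤; +-mono-<-≤; +-mono-≤-<;
         *-monoʳ-≤; *-monoʳ-<; ^-monoˡ-≤; ^-monoˡ-<; ≤-trans; ≤-reflexive; <⇒≤; <⇒≢; <-cmp;
         m≤m+n; m≤n+m; m≤n⇒∃[o]m+o≡n; n<1+n)
open import Data.Product using (Σ; ∃; ∄; _×_; _,_; proj₁)
open import Data.Sum using (_⊎_; inj₁; inj₂; [_,_]′) renaming (map to map⊎)
open import Data.Sum.Properties using (map-cong; map-map; map-id)
open import Function.Base using (_∘_; id)
open import Function.Bundles using (Injection; Inverse; mk↔ₛ′)
open import Function.Definitions using (Injective; Surjective)
open import Function.Properties.Inverse using (↔-refl; ↔-sym; ↔-trans; ↔⇒↣)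
open import Level using (0ℓ)
open import Relation.Binary.Definitions using (tri<; tri≈; tri>)
open import Relation.Binary.PropositionalEquality
  using (_≡_; _≢_; _≗_; refl; sym; trans; cong; cong₂; subst; module ≡-Reasoning)
open import Relation.Nullary using (Dec; yes; no; ¬_; ¬?; _×-dec_; decidable-stable; contradiction)
open import Relation.Unary using (Pred; Decidable)

open import Algebra.Properties.Semiring.Sum +-*-semiring
  using (sum; sum-syntax; sum-cong-≗; sum-permute; *-distribˡ-sum; *-distribʳ-sum; sum-init-last)

open import Defs hiding (_^_)
import Defs

-- Finite sums and polynomials over ℕ

sum-↑ : ∀ a {b} (h : Fin (a + b) → ℕ) →
        sum h ≡ ∑[ i < a ] h (i ↑ˡ b) + ∑[ j < b ] h (a ↑ʳ j)
sum-↑ zero    h = refl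
sum-↑ (suc a) h = trans (cong (h zero +_) (sum-↑ a (h ∘ suc))) (sym (+-assoc (h zero) _ _))

sum-combine : ∀ a {b} (h : Fin (a * b) → ℕ) →
              sum h ≡ ∑[ i < a ] ∑[ j < b ] h (combine i j)
sum-combine zero    h = refl
sum-combine (suc a) {b} h =
  trans (sum-↑ b h) (cong (∑[ j < b ] h (j ↑ˡ a * b) +_) (sum-combine a (h ∘ (b ↑ʳ_))))

sum-ones : ∀ n → ∑[ i < n ] 1 ≡ n
sum-ones zero    = refl
sum-ones (suc n) = cong suc (sum-ones n)

≤-sum : ∀ {n} (h : Fin n → ℕ) i → h i ≤ sum h
≤-sum h zero    = m≤m+n (h zero) _
≤-sum h (suc i) = ≤-trans (≤-sum (h ∘ suc) i) (m≤n+m _ (h zero))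

sum>0⇒∃ : ∀ {n} (h : Fin n → ℕ) → 0 < sum h → ∃ λ i → 0 < h i
sum>0⇒∃ {suc n} h pos with h zero in eq
... | suc _ = zero , subst (0 <_) (sym eq) z<s
... | zero  = let i , hi>0 = sum>0⇒∃ (h ∘ suc) pos in suc i , hi>0

sum-mono-≤ : ∀ {n} {g h : Fin n → ℕ} → (∀ i → g i ≤ h i) → sum g ≤ sum h
sum-mono-≤ {zero}  g≤h = z≤n
sum-mono-≤ {suc n} g≤h = +-mono-≤ (g≤h zero) (sum-mono-≤ (g≤h ∘ suc))

sum-mono-< : ∀ {n} {g h : Fin n → ℕ} → (∀ i → g i ≤ h i) → ∀ j → g j < h j → sum g < sum h
sum-mono-< g≤h zero    gj<hj = +-mono-<-≤ gj<hj (sum-mono-≤ (g≤h ∘ suc))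
sum-mono-< g≤h (suc j) gj<hj = +-mono-≤-< (g≤h zero) (sum-mono-< (g≤h ∘ suc) j gj<hj)

evalPolyℕ : (k : ℕ) → (Fin (suc k) → ℕ) → ℕ → ℕ
evalPolyℕ k c u = ∑[ i < suc k ] (c i * u ^ toℕ i)

evalPolyℕ-strictMono : ∀ k (c : Fin (suc k) → ℕ) j → j ≢ zero → 0 < c j →
                       ∀ {u v} → u < v → evalPolyℕ k c u < evalPolyℕ k c v
evalPolyℕ-strictMono k c zero    j≢0 _    _   = contradiction refl j≢0
evalPolyℕ-strictMono k c (suc j) _   cj>0 u<v =
  sum-mono-< (λ i → *-monoʳ-≤ (c i) (^-monoˡ-≤ (toℕ i) (<⇒≤ u<v))) (suc j)
    (*-monoʳ-< (c (suc j)) {{>-nonZero cj>0}} (^-monoˡ-< (suc (toℕ j)) u<v))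

evalPolyℕ-injective : ∀ k (c : Fin (suc k) → ℕ) j → j ≢ zero → 0 < c j →
                      ∀ {u v} → evalPolyℕ k c u ≡ evalPolyℕ k c v → u ≡ v
evalPolyℕ-injective k c j j≢0 cj>0 {u} {v} eq with <-cmp u v
... | tri< u<v _ _ = contradiction eq (<⇒≢ (evalPolyℕ-strictMono k c j j≢0 cj>0 u<v))
... | tri≈ _ u≡v _ = u≡v
... | tri> _ _ v<u = contradiction (sym eq) (<⇒≢ (evalPolyℕ-strictMono k c j j≢0 cj>0 v<u))

least-witness : ∀ {P : Pred ℕ 0ℓ} → Decidable P → ∀ {n} → P n →
                ∃ λ t → P t × (∀ {s} → s < t → ¬ P s)
least-witness {P} P? {n} Pn =
  let i , ¬¬Pi , below = ¬∀⟶∃¬-smallest (suc n) (¬_ ∘ P ∘ toℕ) (¬? ∘ P? ∘ toℕ)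
                           (λ ∀¬P → ∀¬P (fromℕ n) (subst P (sym (toℕ-fromℕ n)) Pn))
  in toℕ i , decidable-stable (P? (toℕ i)) ¬¬Pi ,
     λ s<i → subst (¬_ ∘ P) (trans (toℕ-inject (fromℕ< s<i)) (toℕ-fromℕ< s<i)) (below (fromℕ< s<i))

-- Iteration: fold x f t is fᵗ x

fold-intertwine : ∀ {A B : Set} {f : A → A} {g : B → B} (h : A → B) → (∀ x → h (f x) ≡ g (h x)) →
                  ∀ x t → h (fold x f t) ≡ fold (h x) g t
fold-intertwine h comm x zero            = refl
fold-intertwine {g = g} h comm x (suc t) = trans (comm _) (cong g (fold-intertwine h comm x t))

module _ {A : Set} {f : A → A} where

  fold-fixed : ∀ {x} → f x ≡ x → ∀ t → fold x f t ≡ x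
  fold-fixed fx≡x zero    = refl
  fold-fixed fx≡x (suc t) = trans (cong f (fold-fixed fx≡x t)) fx≡x

  fold-injective : Injective _≡_ _≡_ f → ∀ t → Injective _≡_ _≡_ (λ x → fold x f t)
  fold-injective f-inj zero    eq = eq
  fold-injective f-inj (suc t) eq = fold-injective f-inj t (f-inj eq)

  fold-multiple : ∀ {x p} → fold x f p ≡ x → ∀ q → fold x f (q * p) ≡ x
  fold-multiple fp≡x zero = refl
  fold-multiple {x} {p} fp≡x (suc q) =
    trans (fold-+ x f p {q * p}) (trans (cong (λ y → fold y f p) (fold-multiple fp≡x q)) fp≡x)

  fold-% : ∀ {x p} .{{_ : NonZero p}} → fold x f p ≡ x → ∀ m → fold x f (m % p) ≡ fold x f m
  fold-% {x} {p} fp≡x m = sym (begin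
    fold x f m                             ≡⟨ cong (fold x f) (m≡m%n+[m/n]*n m p) ⟩
    fold x f (m % p + m / p * p)           ≡⟨ fold-+ x f (m % p) ⟩
    fold (fold x f (m / p * p)) f (m % p)  ≡⟨ cong (λ y → fold y f (m % p)) (fold-multiple fp≡x (m / p)) ⟩
    fold x f (m % p)                       ∎)
    where open ≡-Reasoning

  fold-collision : Injective _≡_ _≡_ f → ∀ {x a b} → a < b → fold x f a ≡ fold x f b →
                   ∃ λ d → suc d ≤ b × fold x f (suc d) ≡ x
  fold-collision f-inj {x} {a} {b} a<b eq =
    let d , a+1+d≡b = m≤n⇒∃[o]m+o≡n a<b
        a+[1+d]≡b   = trans (+-suc a d) a+1+d≡b
    in d , subst (suc d ≤_) a+[1+d]≡b (m≤n+m (suc d) a) ,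
       fold-injective f-inj a (trans (sym (fold-+ x f a)) (trans (cong (fold x f) a+[1+d]≡b) (sym eq)))

injective⇒recurrent : ∀ {n} {f : Fin n → Fin n} → Injective _≡_ _≡_ f →
                      ∀ x → ∃ λ d → fold x f (suc d) ≡ x
injective⇒recurrent {n} {f} f-inj x =
  let _ , _ , i<j , eq   = pigeonhole (n<1+n n) (λ i → fold x f (toℕ i))
      d , _ , periodic   = fold-collision {f = f} f-inj i<j eq
  in d , periodic

-- Counting periodic points

indicator : ∀ {P : Set} → Dec P → ℕ
indicator (yes _) = 1
indicator (no _)  = 0

indicator-yes : ∀ {P : Set} → P → (p : Dec P) → indicator p ≡ 1
indicator-yes _  (yes _) = refl
indicator-yes pr (no ¬p) = contradiction pr ¬p

indicator>0 : ∀ {P : Set} (p : Dec P) → 0 < indicator p → P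
indicator>0 (yes pr) _ = pr

indicator-cong : ∀ {P Q : Set} → (P → Q) → (Q → P) → (p : Dec P) (q : Dec Q) → indicator p ≡ indicator q
indicator-cong _   _   (yes _) (yes _) = refl
indicator-cong _   _   (no _)  (no _)  = refl
indicator-cong P→Q _   (yes p) (no ¬q) = contradiction (P→Q p) ¬q
indicator-cong _   Q→P (no ¬p) (yes q) = contradiction (Q→P q) ¬p

indicator-× : ∀ {P Q : Set} (p : Dec P) (q : Dec Q) → indicator (p ×-dec q) ≡ indicator p * indicator q
indicator-× (yes _) (yes _) = refl
indicator-× (yes _) (no _)  = refl
indicator-× (no _)  _       = refl

indicator-≟-injective : ∀ {m n} {h : Fin m → Fin n} → Injective _≡_ _≡_ h →
                        ∀ x y → indicator (h x ≟ h y) ≡ indicator (x ≟ y)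
indicator-≟-injective h-inj x y = indicator-cong h-inj (cong _) (_ ≟ _) (_ ≟ _)

indicator-combine : ∀ {m n} (a i : Fin m) (b j : Fin n) →
                    indicator (combine a b ≟ combine i j) ≡ indicator (a ≟ i) * indicator (b ≟ j)
indicator-combine a i b j =
  trans (indicator-cong (combine-injective a b i j) (λ (a≡i , b≡j) → cong₂ combine a≡i b≡j)
                        (_ ≟ _) ((a ≟ i) ×-dec (b ≟ j)))
        (indicator-× (a ≟ i) (b ≟ j))

periodicPoints : ℕ → FDDS → ℕ
periodicPoints t X = ∑[ x < size X ] indicator (fold x (fn X) t ≟ x)

indicator-periodic-intertwine : ∀ X Y {h : Fin (size X) → Fin (size Y)} → Injective _≡_ _≡_ h →
  (∀ x → h (fn X x) ≡ fn Y (h x)) →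
  ∀ t x → indicator (fold (h x) (fn Y) t ≟ h x) ≡ indicator (fold x (fn X) t ≟ x)
indicator-periodic-intertwine X Y {h} h-inj comm t x =
  trans (cong (λ y → indicator (y ≟ h x)) (sym (fold-intertwine h comm x t)))
        (indicator-≟-injective h-inj _ _)

periodicPoints-cong : ∀ {X Y} → X ≅ Y → ∀ t → periodicPoints t X ≡ periodicPoints t Y
periodicPoints-cong {X} {Y} (φ , comm) t =
  sym (trans (sum-permute _ φ)
             (sum-cong-≗ (indicator-periodic-intertwine X Y (Injection.injective (↔⇒↣ φ)) comm t)))

periodicPoints-zero : ∀ X → periodicPoints 0 X ≡ size X
periodicPoints-zero X =
  trans (sum-cong-≗ {n = size X} {y = λ _ → 1} (λ x → indicator-yes refl (x ≟ x))) (sum-ones (size X))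

periodic⇒periodicPoints>0 : ∀ {X} t {x} → fold x (fn X) t ≡ x → 0 < periodicPoints t X
periodic⇒periodicPoints>0 t {x} periodic =
  ≤-trans (≤-reflexive (sym (indicator-yes periodic (_ ≟ _)))) (≤-sum _ x)

periodicPoints>0⇒periodic : ∀ {X t} → 0 < periodicPoints t X → ∃ λ x → fold x (fn X) t ≡ x
periodicPoints>0⇒periodic pos = let x , term>0 = sum>0⇒∃ _ pos in x , indicator>0 (_ ≟ _) term>0

fn-⊕-↑ˡ : ∀ A B i → fn (A ⊕ B) (i ↑ˡ size B) ≡ fn A i ↑ˡ size B
fn-⊕-↑ˡ A B i = cong (join _ _ ∘ map⊎ (fn A) (fn B)) (splitAt-↑ˡ (size A) i (size B))

fn-⊕-↑ʳ : ∀ A B j → fn (A ⊕ B) (size A ↑ʳ j) ≡ size A ↑ʳ fn B j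
fn-⊕-↑ʳ A B j = cong (join _ _ ∘ map⊎ (fn A) (fn B)) (splitAt-↑ʳ (size A) (size B) j)

periodicPoints-⊕ : ∀ t A B → periodicPoints t (A ⊕ B) ≡ periodicPoints t A + periodicPoints t B
periodicPoints-⊕ t A B = trans (sum-↑ (size A) _) (cong₂ _+_
  (sum-cong-≗ (indicator-periodic-intertwine A (A ⊕ B) (↑ˡ-injective (size B) _ _) (sym ∘ fn-⊕-↑ˡ A B) t))
  (sum-cong-≗ (indicator-periodic-intertwine B (A ⊕ B) (↑ʳ-injective (size A) _ _) (sym ∘ fn-⊕-↑ʳ A B) t)))

fold-combine : ∀ A B t i j →
               fold (combine i j) (fn (A ⊗ B)) t ≡ combine (fold i (fn A) t) (fold j (fn B) t)
fold-combine A B zero    i j = refl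
fold-combine A B (suc t) i j =
  trans (cong (fn (A ⊗ B)) (fold-combine A B t i j))
        (cong (λ (a , b) → combine (fn A a) (fn B b)) (remQuot-combine _ _))

periodicPoints-⊗ : ∀ t A B → periodicPoints t (A ⊗ B) ≡ periodicPoints t A * periodicPoints t B
periodicPoints-⊗ t A B = begin
  periodicPoints t (A ⊗ B)                     ≡⟨ sum-combine (size A) _ ⟩
  ∑[ i < size A ] ∑[ j < size B ] indicator (fold (combine i j) (fn (A ⊗ B)) t ≟ combine i j)
    ≡⟨ sum-cong-≗ (λ i → sum-cong-≗ (λ j →
         trans (cong (λ z → indicator (z ≟ combine i j)) (fold-combine A B t i j))
               (indicator-combine _ i _ j))) ⟩
  ∑[ i < size A ] ∑[ j < size B ] (u i * v j)  ≡⟨ sum-cong-≗ (λ i → *-distribˡ-sum (u i) v) ⟨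
  ∑[ i < size A ] (u i * sum v)                ≡⟨ *-distribʳ-sum (sum v) u ⟨
  sum u * sum v                                ∎
  where
  open ≡-Reasoning
  u = λ i → indicator (fold i (fn A) t ≟ i)
  v = λ j → indicator (fold j (fn B) t ≟ j)

periodicPoints-𝟙 : ∀ t → periodicPoints t 𝟙 ≡ 1
periodicPoints-𝟙 t = cong (_+ 0) (indicator-yes (fold-fixed refl t) _)

periodicPoints-^ : ∀ t X n → periodicPoints t (X Defs.^ n) ≡ periodicPoints t X ^ n
periodicPoints-^ t X zero    = periodicPoints-𝟙 t
periodicPoints-^ t X (suc n) =
  trans (periodicPoints-⊗ t X (X Defs.^ n)) (cong (periodicPoints t X *_) (periodicPoints-^ t X n))

periodicPoints-sumTo : ∀ t k f → periodicPoints t (sumTo k f) ≡ ∑[ i < suc k ] periodicPoints t (f i)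
periodicPoints-sumTo t zero    f = sym (+-identityʳ _)
periodicPoints-sumTo t (suc k) f =
  trans (periodicPoints-⊕ t (sumTo k (f ∘ inject₁)) (f (fromℕ (suc k))))
        (trans (cong (_+ periodicPoints t (f (fromℕ (suc k)))) (periodicPoints-sumTo t k (f ∘ inject₁)))
               (sym (sum-init-last (λ i → periodicPoints t (f i)))))

periodicPoints-evalPoly : ∀ t k A X →
  periodicPoints t (evalPoly k A X) ≡ evalPolyℕ k (λ i → periodicPoints t (A i)) (periodicPoints t X)
periodicPoints-evalPoly t k A X =
  trans (periodicPoints-sumTo t k (λ i → A i ⊗ (X Defs.^ toℕ i)))
        (sum-cong-≗ (λ i → trans (periodicPoints-⊗ t (A i) (X Defs.^ toℕ i))
                                 (cong (periodicPoints t (A i) *_) (periodicPoints-^ t X (toℕ i)))))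

-- Isomorphisms and invariant subsystems

≅-refl : ∀ {X} → X ≅ X
≅-refl = ↔-refl , λ _ → refl

≅-sym : ∀ {X Y} → X ≅ Y → Y ≅ X
≅-sym {X} {Y} (φ , comm) = ↔-sym φ , λ y → begin
  from (fn Y y)              ≡⟨ cong (from ∘ fn Y) (strictlyInverseˡ y) ⟨
  from (fn Y (to (from y)))  ≡⟨ cong from (comm (from y)) ⟨
  from (to (fn X (from y)))  ≡⟨ strictlyInverseʳ _ ⟩
  fn X (from y)              ∎
  where open Inverse φ
        open ≡-Reasoning

≅-trans : ∀ {X Y Z} → X ≅ Y → Y ≅ Z → X ≅ Z
≅-trans (φ , φ-comm) (ψ , ψ-comm) =
  ↔-trans φ ψ , λ x → trans (cong (Inverse.to ψ) (φ-comm x)) (ψ-comm _)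

≅-empty : ∀ {X Y} → size X ≡ 0 → size Y ≡ 0 → X ≅ Y
≅-empty {mkFDDS _ _} {mkFDDS _ _} refl refl = mk↔ₛ′ (λ ()) (λ ()) (λ ()) (λ ()) , λ ()

joinMap : ∀ {a a′ b b′} → (Fin a → Fin a′) → (Fin b → Fin b′) → Fin (a + b) → Fin (a′ + b′)
joinMap {a} {a′} {b} {b′} p q z = join a′ b′ (map⊎ p q (splitAt a z))

joinMap-id : ∀ {a b} → joinMap {a} {a} {b} {b} id id ≗ id
joinMap-id {a} {b} z = trans (cong (join a b) (map-id (splitAt a z))) (join-splitAt a b z)

joinMap-cong : ∀ {a a′ b b′} {p p′ : Fin a → Fin a′} {q q′ : Fin b → Fin b′} →
               p ≗ p′ → q ≗ q′ → joinMap p q ≗ joinMap p′ q′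
joinMap-cong {a} {a′} {b} {b′} p≗p′ q≗q′ z = cong (join a′ b′) (map-cong p≗p′ q≗q′ (splitAt a z))

joinMap-∘ : ∀ {a a′ a″ b b′ b″} (p : Fin a′ → Fin a″) (q : Fin b′ → Fin b″)
            (p′ : Fin a → Fin a′) (q′ : Fin b → Fin b′) →
            joinMap p q ∘ joinMap p′ q′ ≗ joinMap (p ∘ p′) (q ∘ q′)
joinMap-∘ {a} {a′} {b = b} {b′} p q p′ q′ z =
  trans (cong (join _ _ ∘ map⊎ p q) (splitAt-join a′ b′ (map⊎ p′ q′ (splitAt a z))))
        (cong (join _ _) (map-map {f = p′} {q′} {p} {q} (splitAt a z)))

joinMap-inverse : ∀ {a a′ b b′} (p : Fin a′ → Fin a) (p′ : Fin a → Fin a′)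
                  (q : Fin b′ → Fin b) (q′ : Fin b → Fin b′) →
                  (∀ x → p (p′ x) ≡ x) → (∀ y → q (q′ y) ≡ y) →
                  ∀ z → joinMap p q (joinMap p′ q′ z) ≡ z
joinMap-inverse {a} {b = b} p p′ q q′ pp′ qq′ z =
  trans (joinMap-∘ p q p′ q′ z) (trans (joinMap-cong pp′ qq′ z) (joinMap-id {a} {b} z))

⊕-cong : ∀ {A A′ B B′} → A ≅ A′ → B ≅ B′ → (A ⊕ B) ≅ (A′ ⊕ B′)
⊕-cong {A} {A′} {B} {B′} (φ , φ-comm) (ψ , ψ-comm) =
  mk↔ₛ′ (joinMap φ.to ψ.to) (joinMap φ.from ψ.from)
        (joinMap-inverse φ.to φ.from ψ.to ψ.from φ.strictlyInverseˡ ψ.strictlyInverseˡ)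
        (joinMap-inverse φ.from φ.to ψ.from ψ.to φ.strictlyInverseʳ ψ.strictlyInverseʳ) ,
  λ z → begin
    joinMap φ.to ψ.to (joinMap (fn A) (fn B) z)   ≡⟨ joinMap-∘ φ.to ψ.to (fn A) (fn B) z ⟩
    joinMap (φ.to ∘ fn A) (ψ.to ∘ fn B) z         ≡⟨ joinMap-cong φ-comm ψ-comm z ⟩
    joinMap (fn A′ ∘ φ.to) (fn B′ ∘ ψ.to) z       ≡⟨ joinMap-∘ (fn A′) (fn B′) φ.to ψ.to z ⟨
    joinMap (fn A′) (fn B′) (joinMap φ.to ψ.to z) ∎
  where
  module φ = Inverse φ
  module ψ = Inverse ψ
  open ≡-Reasoning

-- index takes its membership proof irrelevantly: the predicate enumerated below is a
-- negation, whose proofs cannot be shown equal without function extensionality.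
record Enumeration {n} (P : Pred (Fin n) 0ℓ) : Set where
  field
    count         : ℕ
    element       : Fin count → Fin n
    element∈      : ∀ i → P (element i)
    index         : ∀ y → .(P y) → Fin count
    element-index : ∀ y .(Py : P y) → element (index y Py) ≡ y
    index-element : ∀ i → index (element i) (element∈ i) ≡ i

  index-cong : ∀ {y y′} .(Py : P y) .(Py′ : P y′) → y ≡ y′ → index y Py ≡ index y′ Py′
  index-cong _ _ refl = refl

  element-injective : Injective _≡_ _≡_ element
  element-injective {i} {i′} eq =
    trans (sym (index-element i)) (trans (index-cong _ _ eq) (index-element i′))

open Enumeration

module _ {n} {P : Pred (Fin (suc n)) 0ℓ} where

  keep : P zero → Enumeration (P ∘ suc) → Enumeration P
  keep P0 E .count                    = suc (E .count)
  keep P0 E .element zero             = zero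
  keep P0 E .element (suc i)          = suc (E .element i)
  keep P0 E .element∈ zero            = P0
  keep P0 E .element∈ (suc i)         = E .element∈ i
  keep P0 E .index zero _             = zero
  keep P0 E .index (suc y) Py         = suc (E .index y Py)
  keep P0 E .element-index zero _     = refl
  keep P0 E .element-index (suc y) Py = cong suc (E .element-index y Py)
  keep P0 E .index-element zero       = refl
  keep P0 E .index-element (suc i)    = cong suc (E .index-element i)

  skip : ¬ P zero → Enumeration (P ∘ suc) → Enumeration P
  skip ¬P0 E .count                    = E .count
  skip ¬P0 E .element i                = suc (E .element i)
  skip ¬P0 E .element∈                 = E .element∈
  skip ¬P0 E .index zero P0            = ⊥-elim-irr (¬P0 P0)
  skip ¬P0 E .index (suc y) Py         = E .index y Py
  skip ¬P0 E .element-index zero P0    = ⊥-elim-irr (¬P0 P0)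
  skip ¬P0 E .element-index (suc y) Py = cong suc (E .element-index y Py)
  skip ¬P0 E .index-element            = E .index-element

enumerate : ∀ {n} {P : Pred (Fin n) 0ℓ} → Decidable P → Enumeration P
enumerate {zero} P? = record
  { count = 0 ; element = λ () ; element∈ = λ () ; index = λ ()
  ; element-index = λ () ; index-element = λ () }
enumerate {suc n} P? with P? zero
... | yes P0 = keep P0 (enumerate (P? ∘ suc))
... | no ¬P0 = skip ¬P0 (enumerate (P? ∘ suc))

module _ {C X : FDDS} (C-surj : Surjective _≡_ _≡_ (fn C)) (X-inj : Injective _≡_ _≡_ (fn X))
         {e : Fin (size C) → Fin (size X)} (e-inj : Injective _≡_ _≡_ e)
         (e-comm : ∀ j → e (fn C j) ≡ fn X (e j)) where

  private
    Outside : Pred (Fin (size X)) 0ℓ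
    Outside y = ∄ λ j → e j ≡ y

    -- The image of e is closed under preimages because fn C is onto.
    outside-closed : ∀ {y} → Outside y → Outside (fn X y)
    outside-closed {y} y∉ (j , ej≡fy) =
      let j′ , cj′≡j = C-surj j
      in y∉ (j′ , X-inj (trans (sym (e-comm j′)) (trans (cong e (cj′≡j refl)) ej≡fy)))

    R : Enumeration Outside
    R = enumerate (λ y → ¬? (any? λ j → e j ≟ y))

    rest : FDDS
    rest = mkFDDS (R .count) (λ i → R .index (fn X (R .element i)) (outside-closed (R .element∈ i)))

    rest-injective : Injective _≡_ _≡_ (fn rest)
    rest-injective {i} {i′} eq = element-injective R (X-inj (begin
      fn X (R .element i)      ≡⟨ element-index R _ _ ⟨
      R .element (fn rest i)   ≡⟨ cong (R .element) eq ⟩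
      R .element (fn rest i′)  ≡⟨ element-index R _ _ ⟩
      fn X (R .element i′)     ∎))
      where open ≡-Reasoning

    glue : Fin (size C) ⊎ Fin (R .count) → Fin (size X)
    glue = [ e , R .element ]′

    sort : Fin (size X) → Fin (size C) ⊎ Fin (R .count)
    sort y with any? (λ j → e j ≟ y)
    ... | yes (j , _) = inj₁ j
    ... | no y∉       = inj₂ (R .index y y∉)

    glue-sort : ∀ y → glue (sort y) ≡ y
    glue-sort y with any? (λ j → e j ≟ y)
    ... | yes (j , ej≡y) = ej≡y
    ... | no y∉          = element-index R y y∉

    sort-glue : ∀ s → sort (glue s) ≡ s
    sort-glue (inj₁ j) with any? (λ j′ → e j′ ≟ e j)
    ... | yes (j′ , ej′≡ej) = cong inj₁ (e-inj ej′≡ej)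
    ... | no ej∉            = contradiction (j , refl) ej∉
    sort-glue (inj₂ i) with any? (λ j → e j ≟ R .element i)
    ... | yes ∈e = contradiction ∈e (R .element∈ i)
    ... | no _   = cong inj₂ (index-element R i)

    glue-comm : ∀ s → glue (map⊎ (fn C) (fn rest) s) ≡ fn X (glue s)
    glue-comm (inj₁ j) = e-comm j
    glue-comm (inj₂ i) = element-index R _ _

  splitOff : Σ FDDS λ X′ → Injective _≡_ _≡_ (fn X′) × (C ⊕ X′) ≅ X
  splitOff = rest , rest-injective ,
    mk↔ₛ′ (glue ∘ splitAt (size C)) (join (size C) (R .count) ∘ sort)
          (λ y → trans (cong glue (splitAt-join (size C) (R .count) (sort y))) (glue-sort y))
          (λ z → trans (cong (join (size C) (R .count)) (sort-glue (splitAt (size C) z)))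
                       (join-splitAt (size C) (R .count) z)) ,
    λ z → trans (cong glue (splitAt-join (size C) (R .count)
                                          (map⊎ (fn C) (fn rest) (splitAt (size C) z))))
                (glue-comm (splitAt (size C) z))

-- Cycles, and permutations with equal periodic-point counts

Cycle : (p : ℕ) .{{_ : NonZero p}} → FDDS
Cycle p = mkFDDS p (λ j → suc (toℕ j) mod p)

Cycle-surjective : ∀ t → Surjective _≡_ _≡_ (fn (Cycle (suc t)))
Cycle-surjective t zero    = fromℕ t , λ { refl → toℕ-injective (begin
  toℕ (suc (toℕ (fromℕ t)) mod suc t)  ≡⟨ toℕ-fromℕ< _ ⟩
  suc (toℕ (fromℕ t)) % suc t          ≡⟨ cong (λ m → suc m % suc t) (toℕ-fromℕ t) ⟩
  suc t % suc t                        ≡⟨ n%n≡0 (suc t) ⟩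
  0                                    ∎) }
  where open ≡-Reasoning
Cycle-surjective t (suc j) = inject₁ j , λ { refl → toℕ-injective (begin
  toℕ (suc (toℕ (inject₁ j)) mod suc t)  ≡⟨ toℕ-fromℕ< _ ⟩
  suc (toℕ (inject₁ j)) % suc t          ≡⟨ cong (λ m → suc m % suc t) (toℕ-inject₁ j) ⟩
  suc (toℕ j) % suc t                    ≡⟨ m<n⇒m%n≡m (s≤s (toℕ<n j)) ⟩
  suc (toℕ j)                            ∎) }
  where open ≡-Reasoning

module _ {X : FDDS} (X-inj : Injective _≡_ _≡_ (fn X)) {x : Fin (size X)} {t : ℕ}
         (periodic : fold x (fn X) (suc t) ≡ x)
         (minimal : ∀ {s} → s < t → fold x (fn X) (suc s) ≢ x) where

  orbit : Fin (suc t) → Fin (size X)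
  orbit j = fold x (fn X) (toℕ j)

  orbit-comm : ∀ j → orbit (fn (Cycle (suc t)) j) ≡ fn X (orbit j)
  orbit-comm j = trans (cong (fold x (fn X)) (toℕ-fromℕ< (m%n<n (suc (toℕ j)) (suc t))))
                       (fold-% {f = fn X} {p = suc t} periodic (suc (toℕ j)))

  private
    orbit-distinct : ∀ i j → toℕ i < toℕ j → orbit i ≢ orbit j
    orbit-distinct i j i<j eq =
      let d , 1+d≤j , periodic′ = fold-collision {f = fn X} X-inj i<j eq
      in minimal (≤-trans 1+d≤j (toℕ≤pred[n] j)) periodic′

  orbit-injective : Injective _≡_ _≡_ orbit
  orbit-injective {i} {j} eq with <-cmp (toℕ i) (toℕ j)
  ... | tri< i<j _ _ = contradiction eq (orbit-distinct i j i<j)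
  ... | tri≈ _ i≡j _ = toℕ-injective i≡j
  ... | tri> _ _ j<i = contradiction (sym eq) (orbit-distinct j i j<i)

-- Opaque, so that the type checker never runs the search for a shortest cycle.
opaque
  shortestPeriod : ∀ {X} → Injective _≡_ _≡_ (fn X) → Fin (size X) →
                   ∃ λ t → 0 < periodicPoints (suc t) X × (∀ {s} → s < t → ¬ 0 < periodicPoints (suc s) X)
  shortestPeriod {X} X-inj x =
    let d , periodic = injective⇒recurrent {f = fn X} X-inj x
    in least-witness (λ s → 0 <? periodicPoints (suc s) X) {d}
                     (periodic⇒periodicPoints>0 {X} (suc d) periodic)

  peelShortestCycle : ∀ {X t} → Injective _≡_ _≡_ (fn X) → 0 < periodicPoints (suc t) X →
                      (∀ {s} → s < t → ¬ 0 < periodicPoints (suc s) X) →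
                      Σ FDDS λ X′ → Injective _≡_ _≡_ (fn X′) × (Cycle (suc t) ⊕ X′) ≅ X
  peelShortestCycle {X} {t} X-inj pos none-shorter with periodicPoints>0⇒periodic {X} {suc t} pos
  ... | x , periodic =
    splitOff (Cycle-surjective t) X-inj
             (orbit-injective X-inj periodic minimal) (orbit-comm X-inj periodic minimal)
    where
    minimal : ∀ {s} → s < t → fold x (fn X) (suc s) ≢ x
    minimal {s} s<t = none-shorter s<t ∘ periodic⇒periodicPoints>0 {X} (suc s)

periodicPoints-cancelˡ : ∀ {C X X′ Y Y′} → (C ⊕ X′) ≅ X → (C ⊕ Y′) ≅ Y →
                         (∀ t → periodicPoints t X ≡ periodicPoints t Y) →
                         ∀ t → periodicPoints t X′ ≡ periodicPoints t Y′
periodicPoints-cancelˡ {C} {X} {X′} {Y} {Y′} C⊕X′≅X C⊕Y′≅Y same t =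
  +-cancelˡ-≡ (periodicPoints t C) _ _ (begin
    periodicPoints t C + periodicPoints t X′  ≡⟨ periodicPoints-⊕ t C X′ ⟨
    periodicPoints t (C ⊕ X′)                 ≡⟨ periodicPoints-cong C⊕X′≅X t ⟩
    periodicPoints t X                        ≡⟨ same t ⟩
    periodicPoints t Y                        ≡⟨ periodicPoints-cong C⊕Y′≅Y t ⟨
    periodicPoints t (C ⊕ Y′)                 ≡⟨ periodicPoints-⊕ t C Y′ ⟩
    periodicPoints t C + periodicPoints t Y′  ∎)
  where open ≡-Reasoning

samePeriodicPoints⇒≅ : ∀ {X Y} → Injective _≡_ _≡_ (fn X) → Injective _≡_ _≡_ (fn Y) →
                       (∀ t → periodicPoints t X ≡ periodicPoints t Y) → X ≅ Y
samePeriodicPoints⇒≅ {X} = go (<-wellFounded (size X))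
  where
  go : ∀ {X Y} → Acc _<_ (size X) → Injective _≡_ _≡_ (fn X) → Injective _≡_ _≡_ (fn Y) →
       (∀ t → periodicPoints t X ≡ periodicPoints t Y) → X ≅ Y
  go {X@(mkFDDS zero _)} {Y} _ _ _ same =
    ≅-empty {X} {Y} refl (trans (sym (periodicPoints-zero Y)) (sym (same 0)))
  go {X@(mkFDDS (suc _) _)} {Y} (acc smaller) X-inj Y-inj same =
    let t , pos , none-shorter = shortestPeriod {X} X-inj zero
        C                      = Cycle (suc t)
        X′ , X′-inj , C⊕X′≅X   = peelShortestCycle {X} X-inj pos none-shorter
        Y′ , Y′-inj , C⊕Y′≅Y   = peelShortestCycle {Y} Y-inj (subst (0 <_) (same (suc t)) pos)
                                   (λ {s} s<t → none-shorter s<t ∘ subst (0 <_) (sym (same (suc s))))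
        X′<X : size X′ < size X
        X′<X = subst (size X′ <_) (↔⇒≡ (proj₁ C⊕X′≅X)) (s≤s (m≤n+m (size X′) t))
        X′≅Y′ = go (smaller X′<X) X′-inj Y′-inj
                   (periodicPoints-cancelˡ {C} {X} {X′} {Y} {Y′} C⊕X′≅X C⊕Y′≅Y same)
    in ≅-trans {X} {C ⊕ X′} {Y} (≅-sym {C ⊕ X′} {X} C⊕X′≅X)
         (≅-trans {C ⊕ X′} {C ⊕ Y′} {Y}
           (⊕-cong {C} {C} {X′} {Y′} (≅-refl {C}) X′≅Y′) C⊕Y′≅Y)

proposition6 : (k : ℕ) (A : Fin (suc k) → FDDS) →
               (∀ i → IsPerm (A i)) →
               Σ (Fin (suc k)) (λ i → (i ≢ zero) × HasFixedPoint (A i)) →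
               (X Y : FDDS) → IsPerm X → IsPerm Y →
               evalPoly k A X ≅ evalPoly k A Y → X ≅ Y
-- The coefficients need not be permutations: periodicPoints t is multiplicative on every FDDS.
proposition6 k A _ (j , j≢0 , a , Aj-fixes-a) X Y X-perm Y-perm PX≅PY =
  samePeriodicPoints⇒≅ (proj₁ X-perm) (proj₁ Y-perm) λ t →
    evalPolyℕ-injective k (λ i → periodicPoints t (A i)) j j≢0
      (periodic⇒periodicPoints>0 t (fold-fixed Aj-fixes-a t))
      (begin
        evalPolyℕ k (λ i → periodicPoints t (A i)) (periodicPoints t X)  ≡⟨ periodicPoints-evalPoly t k A X ⟨
        periodicPoints t (evalPoly k A X)                                ≡⟨ periodicPoints-cong PX≅PY t ⟩
        periodicPoints t (evalPoly k A Y)                                ≡⟨ periodicPoints-evalPoly t k A Y ⟩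
        evalPolyℕ k (λ i → periodicPoints t (A i)) (periodicPoints t Y)  ∎)
  where open ≡-Reasoning
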